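{- For every positive integer $n$, the number of maximal configurations of length $n$ in the Riviera model is equal to the number of permutations $\pi$ of $\{1,\dots,n+4\}$ satisfying $\pi(i)-i\in\{ -2,-1,2\}$ for all $i\in\{1,\dots,n+4\}$.
   Context: Riviera model: a configuration of length $n$ is a word $C=(c_1,\dots,c_n)\in\{0,1\}^n$ ($c_i=1$: lot $i$ occupied; $c_i=0$: empty), with $c_j=0$ for $j\le 0$ and $j\ge n+1$. $C$ is permissible if there is no $i\in\{1,\dots,n\}$ with $c_{i-1}=c_i=c_{i+1}=1$. $C$ is maximal if it is permissible and for every $i$ with $c_i=0$, changing $c_i$ to $1$ yields a non-permissible configuration. -}

module Defs where

open import Data.Bool using (Bool; true; false)
import Data.Bool.Properties as BoolP
open import Data.Nat using (ℕ; zero; suc; _+_; _<?_)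
open import Data.Fin using (Fin; toℕ; fromℕ<)
import Data.Fin.Properties as FinP
open import Data.Vec using (Vec; []; _∷_; lookup; _[_]≔_)
open import Data.List using (List; []; _∷_; map; concatMap; filter; length)
open import Data.List.Base using (allFin)
open import Data.Integer using (ℤ; +_; -[1+_]; _-_)
import Data.Integer.Properties as ℤP
open import Data.Product using (_×_)
open import Data.Sum using (_⊎_)
open import Relation.Binary.PropositionalEquality using (_≡_)
open import Relation.Nullary using (¬_; Dec; yes; no; ¬?)
open import Relation.Nullary.Decidable using (_×-dec_; _→-dec_; _⊎-dec_)

-- A configuration of length n: c_1 … c_n, stored as a vector whose
-- entry at (0-based) index i is c_{i+1}; true = occupied (1).
Config : ℕ → Set
Config n = Vec Bool n

cell : ∀ {n} → Config n → ℕ → Bool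
cell {n} C zero = false
cell {n} C (suc k) with k <? n
... | yes k<n = lookup C (fromℕ< k<n)
... | no _    = false

-- C is permissible: no i ∈ {1..n} with c_{i-1} = c_i = c_{i+1} = 1.
-- (For i : Fin n, the lot is j = toℕ i + 1.)
Permissible : ∀ {n} → Config n → Set
Permissible {n} C = (i : Fin n) →
  ¬ (cell C (toℕ i) ≡ true × cell C (suc (toℕ i)) ≡ true × cell C (suc (suc (toℕ i))) ≡ true)

Maximal : ∀ {n} → Config n → Set
Maximal {n} C = Permissible C × ((i : Fin n) → lookup C i ≡ false → ¬ Permissible (C [ i ]≔ true))

permissible? : ∀ {n} (C : Config n) → Dec (Permissible C)
permissible? C = FinP.all? λ i → ¬? ((cell C (toℕ i) BoolP.≟ true) ×-dec
  ((cell C (suc (toℕ i)) BoolP.≟ true) ×-dec (cell C (suc (suc (toℕ i))) BoolP.≟ true)))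

maximal? : ∀ {n} (C : Config n) → Dec (Maximal C)
maximal? C = permissible? C ×-dec FinP.all? λ i →
  (lookup C i BoolP.≟ false) →-dec ¬? (permissible? (C [ i ]≔ true))

allVecs : ∀ {A : Set} → List A → (n : ℕ) → List (Vec A n)
allVecs xs zero = [] ∷ []
allVecs xs (suc n) = concatMap (λ x → map (x ∷_) (allVecs xs n)) xs

allConfigs : (n : ℕ) → List (Config n)
allConfigs n = allVecs (false ∷ true ∷ []) n

numMaximal : ℕ → ℕ
numMaximal n = length (filter maximal? (allConfigs n))

-- Permutations of {1,…,m}, represented 0-based as the vector of values
-- (π(1),…,π(m)) shifted down by one: a map Fin m → Fin m stored as a
-- Vec, which is a permutation iff it is injective (finite set).

IsPermutation : ∀ {m} → Vec (Fin m) m → Set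
IsPermutation {m} π = (i j : Fin m) → lookup π i ≡ lookup π j → i ≡ j

isPermutation? : ∀ {m} (π : Vec (Fin m) m) → Dec (IsPermutation π)
isPermutation? π = FinP.all? λ i → FinP.all? λ j →
  (lookup π i FinP.≟ lookup π j) →-dec (i FinP.≟ j)

-- π(i) - i ∈ {-2, -1, 2} for all i (the shift by one cancels)
Displacement : ∀ {m} → Vec (Fin m) m → Set
Displacement {m} π = (i : Fin m) →
  let d = (+ toℕ (lookup π i)) - (+ toℕ i) in
  d ≡ -[1+ 1 ] ⊎ d ≡ -[1+ 0 ] ⊎ d ≡ + 2

displacement? : ∀ {m} (π : Vec (Fin m) m) → Dec (Displacement π)
displacement? π = FinP.all? λ i →
  let d = (+ toℕ (lookup π i)) - (+ toℕ i) in
  (d ℤP.≟ -[1+ 1 ]) ⊎-dec ((d ℤP.≟ -[1+ 0 ]) ⊎-dec (d ℤP.≟ + 2))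

GoodPerm : ∀ {m} → Vec (Fin m) m → Set
GoodPerm π = IsPermutation π × Displacement π

goodPerm? : ∀ {m} (π : Vec (Fin m) m) → Dec (GoodPerm π)
goodPerm? π = isPermutation? π ×-dec displacement? π

numGoodPerms : ℕ → ℕ
numGoodPerms m = length (filter goodPerm? (allVecs (allFin m) m))

{-# OPTIONS --safe #-}
module Submission where

-- Both counts are computed by finite automata and compared through a linear recurrence.
-- A configuration is maximal iff the window of five lots around each lot passes a local test:
-- no three consecutive lots are occupied, and an empty lot has two occupied lots among its
-- neighbours that would form a triple with it. So maximal configurations are counted by a
-- transfer recursion whose state is four consecutive lots. A permutation with
-- π(i) − i ∈ {−2, −1, 2} is built position by position, and only the status of the values
-- i − 2, …, i + 1 matters, which gives a second transfer recursion. The state functions of both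
-- (for the second, those of states with at least two values taken) satisfy
-- a (n + 6) + a n = a (n + 2) + a (n + 3) + a (n + 4): it is checked at n = 0 and carried along
-- the transfer step by linearity. The two counts agree for the first six lengths, hence for all.

open import Defs
open import Data.Nat using (ℕ; suc; _+_)
open import Relation.Binary.PropositionalEquality using (_≡_)

open import Data.Bool using (Bool; true; false; T; _∧_; _∨_; not; if_then_else_)
open import Data.Bool.Properties using (∧-conicalˡ; ∧-conicalʳ; ∨-conicalˡ; ∨-zeroʳ; ∨-identityʳ; not-involutive; T-≡)
import Data.Bool.Properties as Bool
open import Data.Empty using (⊥-elim)
open import Data.Fin using (Fin; toℕ; fromℕ<) renaming (zero to fzero; suc to fsuc)
open import Data.Fin.Properties using (toℕ-fromℕ<; toℕ<n; toℕ-injective; 0≢1+n) renaming (suc-injective to fsuc-injective)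
open import Data.Integer using (ℤ; -[1+_]; _⊖_)
import Data.Integer as ℤ
open import Data.Integer.Properties using (m-n≡m⊖n; [1+m]⊖[1+n]≡m⊖n)
open import Data.List using (List; []; _∷_; map; concatMap; filter; length; _++_; tabulate; applyUpTo; allFin)
open import Data.Nat using (zero; _≡ᵇ_; _<ᵇ_; _≤ᵇ_; _<_; _≤_; z≤n; s≤s; z<s; _<?_)
open import Data.Nat.ListAction using (sum)
open import Data.Nat.Properties
  using (+-assoc; +-comm; +-cancelˡ-≡; +-cancelʳ-≡; +-identityʳ; +-suc; +-monoˡ-<; +-commutativeSemigroup;
         ≡ᵇ⇒≡; ≡⇒≡ᵇ; <⇒<ᵇ; <ᵇ⇒<; <⇒≤; ≤-pred; >⇒≢; ≤-refl; ≤-trans; <-trans;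
         n≤1+n; n<1+n; m≤n+m; m<m+n; m<n+m; m<1+n⇒m<n∨m≡n)
open import Algebra.Properties.CommutativeSemigroup +-commutativeSemigroup using () renaming (interchange to +-interchange)
open import Data.Product using (_×_; _,_; proj₁; proj₂)
open import Data.Sum using (_⊎_; inj₁; inj₂)
open import Data.Vec using (Vec; []; _∷_; lookup; _[_]≔_)
open import Function using (_∘_; case_of_; Equivalence)
open import Relation.Binary.PropositionalEquality using (refl; sym; trans; cong; cong₂; subst; _≢_; ≢-sym; module ≡-Reasoning)
open import Relation.Nullary using (¬_; Dec; does; yes; no)
open import Relation.Nullary.Decidable using (dec-true; dec-false; _×-dec_; _⊎-dec_)
open import Relation.Unary using (Pred; Decidable)

count : {A : Set} → (A → Bool) → List A → ℕ
count p [] = 0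
count p (x ∷ xs) = (if p x then 1 else 0) + count p xs

does≡ : ∀ {P : Set} (P? : Dec P) {b : Bool} → (P → b ≡ true) → (b ≡ true → P) → does P? ≡ b
does≡ P? {true} _ from = dec-true P? (from refl)
does≡ P? {false} to _ = dec-false P? λ p → case to p of λ ()

length-filter≡count : ∀ {A : Set} {ℓ} {P : Pred A ℓ} (P? : Decidable P) (p : A → Bool) →
  (∀ x → does (P? x) ≡ p x) → ∀ xs → length (filter P? xs) ≡ count p xs
length-filter≡count P? p agree [] = refl
length-filter≡count P? p agree (x ∷ xs) rewrite agree x with p x
... | true = cong suc (length-filter≡count P? p agree xs)
... | false = length-filter≡count P? p agree xs

count-++ : ∀ {A : Set} (p : A → Bool) xs ys → count p (xs ++ ys) ≡ count p xs + count p ys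
count-++ p [] ys = refl
count-++ p (x ∷ xs) ys = trans (cong (_ +_) (count-++ p xs ys)) (sym (+-assoc (if p x then 1 else 0) (count p xs) (count p ys)))

count-map : ∀ {A B : Set} (p : B → Bool) (f : A → B) xs → count p (map f xs) ≡ count (p ∘ f) xs
count-map p f [] = refl
count-map p f (x ∷ xs) = cong (_ +_) (count-map p f xs)

count-concatMap : ∀ {A B : Set} (p : B → Bool) (f : A → List B) xs →
  count p (concatMap f xs) ≡ sum (map (count p ∘ f) xs)
count-concatMap p f [] = refl
count-concatMap p f (x ∷ xs) =
  trans (count-++ p (f x) (concatMap f xs)) (cong (count p (f x) +_) (count-concatMap p f xs))

count-if-∧ : ∀ {A : Set} (b : Bool) (p : A → Bool) xs → count (λ x → b ∧ p x) xs ≡ (if b then count p xs else 0)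
count-if-∧ true p xs = refl
count-if-∧ false p [] = refl
count-if-∧ false p (x ∷ xs) = count-if-∧ false p xs

sum-map-cong : ∀ {A : Set} {f g : A → ℕ} → (∀ x → f x ≡ g x) → ∀ xs → sum (map f xs) ≡ sum (map g xs)
sum-map-cong f≗g [] = refl
sum-map-cong f≗g (x ∷ xs) = cong₂ _+_ (f≗g x) (sum-map-cong f≗g xs)

count-allVecs : ∀ {A : Set} (as : List A) n (p : Vec A (suc n) → Bool) →
  count p (allVecs as (suc n)) ≡ sum (map (λ a → count (p ∘ (a ∷_)) (allVecs as n)) as)
count-allVecs as n p = trans (count-concatMap p (λ a → map (a ∷_) (allVecs as n)) as)
  (sum-map-cong (λ a → count-map p (a ∷_) (allVecs as n)) as)

sum-tabulate : ∀ {A : Set} k (f : Fin k → A) (g : A → ℕ) (h : ℕ → ℕ) →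
  (∀ i → g (f i) ≡ h (toℕ i)) → sum (map g (tabulate f)) ≡ sum (applyUpTo h k)
sum-tabulate zero f g h g∘f≗h = refl
sum-tabulate (suc k) f g h g∘f≗h = cong₂ _+_ (g∘f≗h fzero) (sum-tabulate k (f ∘ fsuc) g (h ∘ suc) (g∘f≗h ∘ fsuc))

sum-applyUpTo-cong : ∀ {f g : ℕ → ℕ} → (∀ y → f y ≡ g y) → ∀ k → sum (applyUpTo f k) ≡ sum (applyUpTo g k)
sum-applyUpTo-cong f≗g zero = refl
sum-applyUpTo-cong f≗g (suc k) = cong₂ _+_ (f≗g 0) (sum-applyUpTo-cong (f≗g ∘ suc) k)

sum-applyUpTo-+ : ∀ (f g : ℕ → ℕ) k →
  sum (applyUpTo (λ y → f y + g y) k) ≡ sum (applyUpTo f k) + sum (applyUpTo g k)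
sum-applyUpTo-+ f g zero = refl
sum-applyUpTo-+ f g (suc k) = trans (cong ((f 0 + g 0) +_) (sum-applyUpTo-+ (f ∘ suc) (g ∘ suc) k))
  (+-interchange (f 0) (g 0) (sum (applyUpTo (f ∘ suc) k)) (sum (applyUpTo (g ∘ suc) k)))

sum-applyUpTo-0 : ∀ k → sum (applyUpTo (λ _ → 0) k) ≡ 0
sum-applyUpTo-0 zero = refl
sum-applyUpTo-0 (suc k) = sum-applyUpTo-0 k

sum-indicator : ∀ k t (g : ℕ → ℕ) → sum (applyUpTo (λ y → if y ≡ᵇ t then g y else 0) k) ≡ (if t <ᵇ k then g t else 0)
sum-indicator zero t g = refl
sum-indicator (suc k) zero g = trans (cong (g 0 +_) (sum-applyUpTo-0 k)) (+-identityʳ (g 0))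
sum-indicator (suc k) (suc t) g = sum-indicator k t (g ∘ suc)

entry : ∀ {n} → Vec Bool n → ℕ → Bool
entry [] k = false
entry (x ∷ v) zero = x
entry (x ∷ v) (suc k) = entry v k

entry-toℕ : ∀ {n} (v : Vec Bool n) (i : Fin n) → entry v (toℕ i) ≡ lookup v i
entry-toℕ (x ∷ v) fzero = refl
entry-toℕ (x ∷ v) (fsuc i) = entry-toℕ v i

entry-true⇒< : ∀ {n} (v : Vec Bool n) k → entry v k ≡ true → k < n
entry-true⇒< (x ∷ v) zero _ = s≤s z≤n
entry-true⇒< (x ∷ v) (suc k) e = s≤s (entry-true⇒< v k e)

entry-≮ : ∀ {n} (v : Vec Bool n) k → ¬ k < n → entry v k ≡ false
entry-≮ v k k≮n with entry v k in e
... | false = refl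
... | true = ⊥-elim (k≮n (entry-true⇒< v k e))

cell≡entry : ∀ {n} (C : Config n) k → cell C k ≡ entry (false ∷ C) k
cell≡entry C zero = refl
cell≡entry {n} C (suc k) with k <? n
... | yes k<n = trans (sym (entry-toℕ C (fromℕ< k<n))) (cong (entry C) (toℕ-fromℕ< k<n))
... | no k≮n = sym (entry-≮ C k k≮n)

fill : (ℕ → Bool) → ℕ → ℕ → Bool
fill c j k = c k ∨ (k ≡ᵇ j)

fill-same : ∀ c j → fill c j j ≡ true
fill-same c j with j ≡ᵇ j in e
... | true = ∨-zeroʳ (c j)
... | false = ⊥-elim (subst T e (≡⇒≡ᵇ j j refl))

fill-apart : ∀ c {j k} → k ≢ j → fill c j k ≡ c k
fill-apart c {j} {k} k≢j with k ≡ᵇ j in e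
... | true = ⊥-elim (k≢j (≡ᵇ⇒≡ k j (subst T (sym e) _)))
... | false = ∨-identityʳ (c k)

fill-mono : ∀ c j {k} → c k ≡ true → fill c j k ≡ true
fill-mono c j ck rewrite ck = refl

fill-true : ∀ c j k → fill c j k ≡ true → c k ≡ true ⊎ k ≡ j
fill-true c j k e with k ≡ᵇ j in k≡ᵇj
... | true = inj₂ (≡ᵇ⇒≡ k j (subst T (sym k≡ᵇj) _))
... | false = inj₁ (trans (sym (∨-identityʳ (c k))) e)

entry-[]≔ : ∀ {n} (v : Vec Bool n) i k → entry (v [ i ]≔ true) k ≡ fill (entry v) (toℕ i) k
entry-[]≔ (x ∷ v) fzero zero = sym (∨-zeroʳ x)
entry-[]≔ (x ∷ v) fzero (suc k) = sym (∨-identityʳ (entry v k))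
entry-[]≔ (x ∷ v) (fsuc i) zero = sym (∨-identityʳ x)
entry-[]≔ (x ∷ v) (fsuc i) (suc k) = entry-[]≔ v i k

-- Maximality as a local condition

Triple : (ℕ → Bool) → ℕ → Set
Triple c k = c k ≡ true × c (suc k) ≡ true × c (suc (suc k)) ≡ true

Triple-cong : ∀ {c d} → (∀ k → c k ≡ d k) → ∀ {t} → Triple c t → Triple d t
Triple-cong c≗d (x , y , z) = trans (sym (c≗d _)) x , trans (sym (c≗d _)) y , trans (sym (c≗d _)) z

-- Lot j of C is read at index j + 1, behind two empty lots.
padded : ∀ {n} → Config n → ℕ → Bool
padded C = entry (false ∷ false ∷ C)

Permissibleℕ : ℕ → (ℕ → Bool) → Set
Permissibleℕ n c = ∀ t → t < n → ¬ Triple c (suc t)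

Maximalℕ : ℕ → (ℕ → Bool) → Set
Maximalℕ n c = Permissibleℕ n c × (∀ t → t < n → c (2 + t) ≡ false → ¬ Permissibleℕ n (fill c (2 + t)))

Permissibleℕ-cong : ∀ {n c d} → (∀ k → c k ≡ d k) → Permissibleℕ n c → Permissibleℕ n d
Permissibleℕ-cong c≗d P t t<n tri = P t t<n (Triple-cong (sym ∘ c≗d) tri)

permissible⇒ : ∀ {n} (C : Config n) → Permissible C → Permissibleℕ n (padded C)
permissible⇒ C P t t<n tri = P (fromℕ< t<n)
  (Triple-cong (sym ∘ cell≡entry C) (subst (λ s → Triple (padded C) (suc s)) (sym (toℕ-fromℕ< t<n)) tri))

⇒permissible : ∀ {n} (C : Config n) → Permissibleℕ n (padded C) → Permissible C
⇒permissible C P i tri = P (toℕ i) (toℕ<n i) (Triple-cong (cell≡entry C) tri)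

padded-[]≔ : ∀ {n} (C : Config n) i k → padded (C [ i ]≔ true) k ≡ fill (padded C) (2 + toℕ i) k
padded-[]≔ C i = entry-[]≔ (false ∷ false ∷ C) (fsuc (fsuc i))

maximal⇒ : ∀ {n} (C : Config n) → Maximal C → Maximalℕ n (padded C)
maximal⇒ {n} C (P , M) = permissible⇒ C P , λ t t<n →
    subst (λ s → padded C (2 + s) ≡ false → ¬ Permissibleℕ n (fill (padded C) (2 + s)))
          (toℕ-fromℕ< t<n) (saturated (fromℕ< t<n))
  where
  saturated : ∀ i → padded C (2 + toℕ i) ≡ false → ¬ Permissibleℕ n (fill (padded C) (2 + toℕ i))
  saturated i empty PF = M i (trans (sym (entry-toℕ C i)) empty)
    (⇒permissible (C [ i ]≔ true) (Permissibleℕ-cong (sym ∘ padded-[]≔ C i) PF))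

⇒maximal : ∀ {n} (C : Config n) → Maximalℕ n (padded C) → Maximal C
⇒maximal C (P , M) = ⇒permissible C P , λ i empty PP →
  M (toℕ i) (toℕ<n i) (trans (entry-toℕ C i) empty) (Permissibleℕ-cong (padded-[]≔ C i) (permissible⇒ _ PP))

-- a, b, d, e are the lots at offsets −2, −1, 1, 2 from an empty lot, which cannot be filled.
Blocking : Bool → Bool → Bool → Bool → Set
Blocking a b d e = (a ≡ true × b ≡ true) ⊎ (b ≡ true × d ≡ true) ⊎ (d ≡ true × e ≡ true)

LocallyMaximal : (ℕ → Bool) → ℕ → Set
LocallyMaximal c t = ¬ Triple c (suc t) × (c (2 + t) ≡ true ⊎ Blocking (c t) (c (1 + t)) (c (3 + t)) (c (4 + t)))

fill-permissible : ∀ {n c} t → Permissibleℕ n c → ¬ Blocking (c t) (c (1 + t)) (c (3 + t)) (c (4 + t)) →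
  Permissibleℕ n (fill c (2 + t))
fill-permissible {c = c} t P ¬blocking s s<n (x , y , z)
  with fill-true c (2 + t) _ x | fill-true c (2 + t) _ y | fill-true c (2 + t) _ z
... | inj₁ x′ | inj₁ y′ | inj₁ z′ = P s s<n (x′ , y′ , z′)
... | inj₂ refl | inj₁ y′ | inj₁ z′ = ¬blocking (inj₂ (inj₂ (y′ , z′)))
... | inj₁ x′ | inj₂ refl | inj₁ z′ = ¬blocking (inj₂ (inj₁ (x′ , z′)))
... | inj₁ x′ | inj₁ y′ | inj₂ refl = ¬blocking (inj₁ (x′ , y′))
... | inj₂ refl | inj₂ () | _
... | inj₂ refl | inj₁ _ | inj₂ ()
... | inj₁ _ | inj₂ refl | inj₂ ()

blocking-impermissible : ∀ {n c} t → c 0 ≡ false → (∀ k → c k ≡ true → k < 2 + n) → t < n →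
  Blocking (c t) (c (1 + t)) (c (3 + t)) (c (4 + t)) → ¬ Permissibleℕ n (fill c (2 + t))
blocking-impermissible {c = c} zero c₀ _ _ (inj₁ (x , _)) _ = case trans (sym c₀) x of λ ()
blocking-impermissible {c = c} (suc s) _ _ t<n (inj₁ (x , y)) P =
  P s (<-trans (n<1+n s) t<n) (fill-mono c (3 + s) x , fill-mono c (3 + s) y , fill-same c _)
blocking-impermissible {c = c} t _ _ t<n (inj₂ (inj₁ (y , z))) P =
  P t t<n (fill-mono c (2 + t) y , fill-same c _ , fill-mono c (2 + t) z)
blocking-impermissible {c = c} t _ bounded _ (inj₂ (inj₂ (z , w))) P =
  P (suc t) (<⇒≤ (≤-pred (≤-pred (bounded _ w)))) (fill-same c _ , fill-mono c (2 + t) z , fill-mono c (2 + t) w)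

blocking? : ∀ a b d e → Dec (Blocking a b d e)
blocking? a b d e = ((a Bool.≟ true) ×-dec (b Bool.≟ true)) ⊎-dec ((b Bool.≟ true) ×-dec (d Bool.≟ true))
  ⊎-dec ((d Bool.≟ true) ×-dec (e Bool.≟ true))

maximalℕ⇒locallyMaximal : ∀ {n c} → Maximalℕ n c → ∀ t → t < n → LocallyMaximal c t
maximalℕ⇒locallyMaximal {c = c} (P , M) t t<n = P t t<n , occupied-or-blocking
  where
  occupied-or-blocking : c (2 + t) ≡ true ⊎ Blocking (c t) (c (1 + t)) (c (3 + t)) (c (4 + t))
  occupied-or-blocking with c (2 + t) in occupied | blocking? (c t) (c (1 + t)) (c (3 + t)) (c (4 + t))
  ... | true | _ = inj₁ refl
  ... | false | yes blocking = inj₂ blocking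
  ... | false | no ¬blocking = ⊥-elim (M t t<n occupied (fill-permissible {c = c} t P ¬blocking))

locallyMaximal⇒maximalℕ : ∀ {n c} → c 0 ≡ false → (∀ k → c k ≡ true → k < 2 + n) →
  (∀ t → t < n → LocallyMaximal c t) → Maximalℕ n c
locallyMaximal⇒maximalℕ c₀ bounded L = (λ t t<n → proj₁ (L t t<n)) , λ t t<n empty →
  case proj₂ (L t t<n) of λ where
    (inj₁ occupied) → case trans (sym empty) occupied of λ ()
    (inj₂ blocking) → blocking-impermissible t c₀ bounded t<n blocking

-- Counting maximal configurations

localOK : Bool → Bool → Bool → Bool → Bool → Bool
localOK a b x d e = not (b ∧ x ∧ d) ∧ (x ∨ (a ∧ b) ∨ (b ∧ d) ∨ (d ∧ e))

localOK-empty : ∀ a b d e → localOK a b false d e ≡ true → Blocking a b d e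
localOK-empty true true d e _ = inj₁ (refl , refl)
localOK-empty a true true e _ = inj₂ (inj₁ (refl , refl))
localOK-empty a b true true _ = inj₂ (inj₂ (refl , refl))
localOK-empty false true false e ()
localOK-empty true false false e ()
localOK-empty false false false e ()
localOK-empty true false true false ()
localOK-empty false false true false ()

localOK-sound : ∀ a b x d e → localOK a b x d e ≡ true →
  ¬ (b ≡ true × x ≡ true × d ≡ true) × (x ≡ true ⊎ Blocking a b d e)
localOK-sound a b true d e ok = (λ { (refl , _ , refl) → case ok of λ () }) , inj₁ refl
localOK-sound a b false d e ok = (λ ()) , inj₂ (localOK-empty a b d e ok)

localOK-complete : ∀ a b x d e → ¬ (b ≡ true × x ≡ true × d ≡ true) → x ≡ true ⊎ Blocking a b d e →
  localOK a b x d e ≡ true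
localOK-complete a true true true e ¬triple _ = ⊥-elim (¬triple (refl , refl , refl))
localOK-complete a true true false e _ _ = refl
localOK-complete a false true d e _ _ = refl
localOK-complete a b false d e _ (inj₁ ())
localOK-complete .true .true false d e _ (inj₂ (inj₁ (refl , refl))) = refl
localOK-complete true .true false .true e _ (inj₂ (inj₂ (inj₁ (refl , refl)))) = refl
localOK-complete false .true false .true e _ (inj₂ (inj₂ (inj₁ (refl , refl)))) = refl
localOK-complete true true false .true .true _ (inj₂ (inj₂ (inj₂ (refl , refl)))) = refl
localOK-complete true false false .true .true _ (inj₂ (inj₂ (inj₂ (refl , refl)))) = refl
localOK-complete false true false .true .true _ (inj₂ (inj₂ (inj₂ (refl , refl)))) = refl
localOK-complete false false false .true .true _ (inj₂ (inj₂ (inj₂ (refl , refl)))) = refl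

windowOK : (ℕ → Bool) → ℕ → Bool
windowOK c t = localOK (c t) (c (1 + t)) (c (2 + t)) (c (3 + t)) (c (4 + t))

windowsOK : ∀ {n} → Bool → Bool → Bool → Bool → Vec Bool n → Bool
windowsOK a b c d [] = localOK a b c d false ∧ localOK b c d false false
windowsOK a b c d (e ∷ v) = localOK a b c d e ∧ windowsOK b c d e v

windowsOK-sound : ∀ {n} a b c d (v : Vec Bool n) → windowsOK a b c d v ≡ true →
  ∀ t → t < 2 + n → windowOK (entry (a ∷ b ∷ c ∷ d ∷ v)) t ≡ true
windowsOK-sound a b c d [] ok zero _ = ∧-conicalˡ _ _ ok
windowsOK-sound a b c d [] ok (suc zero) _ = ∧-conicalʳ (localOK a b c d false) _ ok
windowsOK-sound a b c d [] ok (suc (suc t)) (s≤s (s≤s ()))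
windowsOK-sound a b c d (e ∷ v) ok zero _ = ∧-conicalˡ _ _ ok
windowsOK-sound a b c d (e ∷ v) ok (suc t) t<n = windowsOK-sound b c d e v (∧-conicalʳ _ _ ok) t (≤-pred t<n)

windowsOK-complete : ∀ {n} a b c d (v : Vec Bool n) →
  (∀ t → t < 2 + n → windowOK (entry (a ∷ b ∷ c ∷ d ∷ v)) t ≡ true) → windowsOK a b c d v ≡ true
windowsOK-complete a b c d [] ok = cong₂ _∧_ (ok 0 (s≤s z≤n)) (ok 1 (s≤s (s≤s z≤n)))
windowsOK-complete a b c d (e ∷ v) ok =
  cong₂ _∧_ (ok 0 (s≤s z≤n)) (windowsOK-complete b c d e v λ t t<n → ok (suc t) (s≤s t<n))

maximalᵇ : ∀ {n} → Config (2 + n) → Bool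
maximalᵇ (c ∷ d ∷ v) = windowsOK false false c d v

maximal⇒maximalᵇ : ∀ {n} (C : Config (2 + n)) → Maximal C → maximalᵇ C ≡ true
maximal⇒maximalᵇ C@(c ∷ d ∷ v) M = windowsOK-complete false false c d v λ t t<n →
  let (¬triple , filled) = maximalℕ⇒locallyMaximal {c = padded C} (maximal⇒ C M) t t<n in
  localOK-complete _ _ _ _ _ ¬triple filled

maximalᵇ⇒maximal : ∀ {n} (C : Config (2 + n)) → maximalᵇ C ≡ true → Maximal C
maximalᵇ⇒maximal C@(c ∷ d ∷ v) ok =
  ⇒maximal C (locallyMaximal⇒maximalℕ {c = padded C} refl (entry-true⇒< (false ∷ false ∷ C)) λ t t<n →
    localOK-sound _ _ _ _ _ (windowsOK-sound false false c d v ok t t<n))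

bits : List Bool
bits = false ∷ true ∷ []

completions : Bool → Bool → Bool → Bool → ℕ → ℕ
completions a b c d n = count (windowsOK a b c d) (allConfigs n)

completions-suc : ∀ a b c d n → completions a b c d (suc n) ≡
  (if localOK a b c d false then completions b c d false n else 0) +
  (if localOK a b c d true then completions b c d true n else 0)
completions-suc a b c d n = trans (count-allVecs bits n (windowsOK a b c d))
  (cong₂ _+_ (count-if-∧ (localOK a b c d false) (windowsOK b c d false) (allConfigs n))
    (trans (+-identityʳ _) (count-if-∧ (localOK a b c d true) (windowsOK b c d true) (allConfigs n))))

maximalCount : ℕ → ℕ
maximalCount n = sum (map (λ c → sum (map (λ d → completions false false c d n) bits)) bits)

numMaximal≡maximalCount : ∀ n → numMaximal (suc (suc n)) ≡ maximalCount n
numMaximal≡maximalCount n = begin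
  numMaximal (suc (suc n))
    ≡⟨ length-filter≡count maximal? maximalᵇ (λ C → does≡ (maximal? C) (maximal⇒maximalᵇ C) (maximalᵇ⇒maximal C))
                             (allConfigs (2 + n)) ⟩
  count maximalᵇ (allConfigs (2 + n))
    ≡⟨ count-allVecs bits (suc n) maximalᵇ ⟩
  sum (map (λ c → count (maximalᵇ ∘ (c ∷_)) (allConfigs (suc n))) bits)
    ≡⟨ sum-map-cong (λ c → count-allVecs bits n (maximalᵇ ∘ (c ∷_))) bits ⟩
  maximalCount n ∎
  where open ≡-Reasoning

-- Counting permutations with displacements in {−2, −1, 2}

allowed : ℕ → ℕ → Bool
allowed o y = (2 + y ≡ᵇ o) ∨ (1 + y ≡ᵇ o) ∨ (y ≡ᵇ 2 + o)

Admissible : ℤ → Set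
Admissible d = d ≡ -[1+ 1 ] ⊎ d ≡ -[1+ 0 ] ⊎ d ≡ ℤ.+ 2

admissible⇒allowed : ∀ y o → Admissible (y ⊖ o) → allowed o y ≡ true
admissible⇒allowed zero zero (inj₁ ())
admissible⇒allowed zero zero (inj₂ (inj₁ ()))
admissible⇒allowed zero zero (inj₂ (inj₂ ()))
admissible⇒allowed zero 1 _ = refl
admissible⇒allowed zero 2 _ = refl
admissible⇒allowed zero (suc (suc (suc o))) (inj₁ ())
admissible⇒allowed zero (suc (suc (suc o))) (inj₂ (inj₁ ()))
admissible⇒allowed zero (suc (suc (suc o))) (inj₂ (inj₂ ()))
admissible⇒allowed (suc y) zero (inj₁ ())
admissible⇒allowed (suc y) zero (inj₂ (inj₁ ()))
admissible⇒allowed (suc .1) zero (inj₂ (inj₂ refl)) = refl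
admissible⇒allowed (suc y) (suc o) a = admissible⇒allowed y o (subst Admissible ([1+m]⊖[1+n]≡m⊖n y o) a)

allowed⇒admissible : ∀ y o → allowed o y ≡ true → Admissible (y ⊖ o)
allowed⇒admissible zero zero ()
allowed⇒admissible zero 1 _ = inj₂ (inj₁ refl)
allowed⇒admissible zero 2 _ = inj₁ refl
allowed⇒admissible zero (suc (suc (suc o))) ()
allowed⇒admissible 1 zero ()
allowed⇒admissible 2 zero _ = inj₂ (inj₂ refl)
allowed⇒admissible (suc (suc (suc y))) zero ()
allowed⇒admissible (suc y) (suc o) a = subst Admissible (sym ([1+m]⊖[1+n]≡m⊖n y o)) (allowed⇒admissible y o a)

allowed-suc : ∀ o i y → allowed (o + suc i) y ≡ allowed (suc o + i) y
allowed-suc o i y = cong (λ p → allowed p y) (+-suc o i)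

allowed-zero : ∀ o y → allowed (o + 0) y ≡ allowed o y
allowed-zero o y = cong (λ p → allowed p y) (+-identityʳ o)

split-allowed : ∀ o y (z : ℕ) → (if allowed o y then z else 0) ≡
  (if 2 + y ≡ᵇ o then z else 0) + ((if 1 + y ≡ᵇ o then z else 0) + (if y ≡ᵇ 2 + o then z else 0))
split-allowed zero y z = refl
split-allowed 1 zero z = sym (+-identityʳ z)
split-allowed 2 zero z = sym (+-identityʳ z)
split-allowed (suc (suc (suc o))) zero z = refl
split-allowed (suc o) (suc y) z = split-allowed o y z

if-∧-not : ∀ a b (x : ℕ) → (if a ∧ not b then x else 0) ≡ (if a then (if b then 0 else x) else 0)
if-∧-not false b x = refl
if-∧-not true false x = refl
if-∧-not true true x = refl

-- b₀ b₁ b₂ b₃ record which of the values o − 2, o − 1, o, o + 1 are taken when position o is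
-- next; the last argument is m − o, so o + 2 is a value iff 2 is below it.
arrangements : Bool → Bool → Bool → Bool → ℕ → ℕ
arrangements b₀ b₁ b₂ b₃ zero = 1
arrangements b₀ b₁ b₂ b₃ (suc k) =
  (if b₀ then 0 else arrangements b₁ b₂ b₃ false k) +
  ((if b₁ then 0 else arrangements true b₂ b₃ false k) +
   (if 2 <ᵇ suc k then arrangements b₁ b₂ b₃ true k else 0))

-- w (2 + y) records whether the value y is taken; w 0 and w 1 stand for the nonexistent
-- values −2 and −1, so the state of position o is w o, …, w (3 + o).
record Window (o : ℕ) (w : ℕ → Bool) (b₀ b₁ b₂ b₃ : Bool) : Set where
  field
    negatives : w 0 ≡ true × w 1 ≡ true
    at₀ : w o ≡ b₀
    at₁ : w (1 + o) ≡ b₁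
    at₂ : w (2 + o) ≡ b₂
    at₃ : w (3 + o) ≡ b₃
    beyond : ∀ z → 4 + o ≤ z → w z ≡ false

module _ {o w b₀ b₁ b₂ b₃} (W : Window o w b₀ b₁ b₂ b₃) where
  open Window W

  private
    k+o≢o : ∀ k o → suc k + o ≢ o
    k+o≢o k o = >⇒≢ (m<n+m o z<s)

    fill-negatives : ∀ j → fill w j 0 ≡ true × fill w j 1 ≡ true
    fill-negatives j = fill-mono w j (proj₁ negatives) , fill-mono w j (proj₂ negatives)

    fill-beyond : ∀ {j} → j ≤ 4 + o → ∀ z → 5 + o ≤ z → fill w j z ≡ false
    fill-beyond j≤ z z≥ = trans (fill-apart w (>⇒≢ (≤-trans (s≤s j≤) z≥))) (beyond z (≤-trans (n≤1+n _) z≥))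

  Window-take₋₂ : Window (suc o) (fill w o) b₁ b₂ b₃ false
  Window-take₋₂ = record
    { negatives = fill-negatives o
    ; at₀ = trans (fill-apart w (k+o≢o 0 o)) at₁
    ; at₁ = trans (fill-apart w (k+o≢o 1 o)) at₂
    ; at₂ = trans (fill-apart w (k+o≢o 2 o)) at₃
    ; at₃ = trans (fill-apart w (k+o≢o 3 o)) (beyond _ ≤-refl)
    ; beyond = fill-beyond (m≤n+m o 4)
    }

  Window-take₋₁ : Window (suc o) (fill w (1 + o)) true b₂ b₃ false
  Window-take₋₁ = record
    { negatives = fill-negatives (1 + o)
    ; at₀ = fill-same w (1 + o)
    ; at₁ = trans (fill-apart w (k+o≢o 0 (1 + o))) at₂
    ; at₂ = trans (fill-apart w (k+o≢o 1 (1 + o))) at₃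
    ; at₃ = trans (fill-apart w (k+o≢o 2 (1 + o))) (beyond _ ≤-refl)
    ; beyond = fill-beyond (m≤n+m (1 + o) 3)
    }

  Window-take₊₂ : Window (suc o) (fill w (4 + o)) b₁ b₂ b₃ true
  Window-take₊₂ = record
    { negatives = fill-negatives (4 + o)
    ; at₀ = trans (fill-apart w (≢-sym (k+o≢o 2 (1 + o)))) at₁
    ; at₁ = trans (fill-apart w (≢-sym (k+o≢o 1 (2 + o)))) at₂
    ; at₂ = trans (fill-apart w (≢-sym (k+o≢o 0 (3 + o)))) at₃
    ; at₃ = fill-same w (4 + o)
    ; beyond = fill-beyond ≤-refl
    }

module Placements (m : ℕ) where

  accepts : ∀ {k} → ℕ → (ℕ → Bool) → Vec (Fin m) k → Bool
  accepts o w [] = true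
  accepts o w (x ∷ v) = (allowed o (toℕ x) ∧ not (w (2 + toℕ x))) ∧ accepts (suc o) (fill w (2 + toℕ x)) v

  InjectiveVec : ∀ {k} → Vec (Fin m) k → Set
  InjectiveVec {k} v = (i j : Fin k) → lookup v i ≡ lookup v j → i ≡ j

  Valid : ∀ {k} → ℕ → (ℕ → Bool) → Vec (Fin m) k → Set
  Valid o w v = InjectiveVec v × (∀ i → allowed (o + toℕ i) (toℕ (lookup v i)) ≡ true)
                              × (∀ i → w (2 + toℕ (lookup v i)) ≡ false)

  valid⇒accepts : ∀ {k} o w (v : Vec (Fin m) k) → Valid o w v → accepts o w v ≡ true
  valid⇒accepts o w [] _ = refl
  valid⇒accepts o w (x ∷ v) (inj , allow , free) =
    cong₂ _∧_ (cong₂ _∧_ (trans (sym (allowed-zero o (toℕ x))) (allow fzero)) (cong not (free fzero)))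
      (valid⇒accepts (suc o) (fill w (2 + toℕ x)) v
        ((λ i j e → fsuc-injective (inj (fsuc i) (fsuc j) e)) ,
         (λ i → trans (sym (allowed-suc o (toℕ i) _)) (allow (fsuc i))) ,
         (λ i → trans (fill-apart w (λ e → 0≢1+n (inj fzero (fsuc i) (sym (toℕ-injective (+-cancelˡ-≡ 2 _ _ e))))))
                      (free (fsuc i)))))

  accepts⇒valid : ∀ {k} o w (v : Vec (Fin m) k) → accepts o w v ≡ true → Valid o w v
  accepts⇒valid o w [] _ = (λ ()) , (λ ()) , (λ ())
  accepts⇒valid o w (x ∷ v) ok = inj , allow , free
    where
    head : allowed o (toℕ x) ∧ not (w (2 + toℕ x)) ≡ true
    head = ∧-conicalˡ _ _ ok
    x-free : w (2 + toℕ x) ≡ false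
    x-free = trans (sym (not-involutive _)) (cong not (∧-conicalʳ (allowed o (toℕ x)) _ head))
    tail : Valid (suc o) (fill w (2 + toℕ x)) v
    tail = accepts⇒valid (suc o) (fill w (2 + toℕ x)) v (∧-conicalʳ _ _ ok)
    x-unused : ∀ j → x ≢ lookup v j
    x-unused j refl = case trans (sym (fill-same w _)) (proj₂ (proj₂ tail) j) of λ ()
    inj : InjectiveVec (x ∷ v)
    inj fzero fzero _ = refl
    inj fzero (fsuc j) e = ⊥-elim (x-unused j e)
    inj (fsuc i) fzero e = ⊥-elim (x-unused i (sym e))
    inj (fsuc i) (fsuc j) e = cong fsuc (proj₁ tail i j e)
    allow : ∀ i → allowed (o + toℕ i) (toℕ (lookup (x ∷ v) i)) ≡ true
    allow fzero = trans (allowed-zero o (toℕ x)) (∧-conicalˡ _ _ head)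
    allow (fsuc i) = trans (allowed-suc o (toℕ i) _) (proj₁ (proj₂ tail) i)
    free : ∀ i → w (2 + toℕ (lookup (x ∷ v) i)) ≡ false
    free fzero = x-free
    free (fsuc i) = ∨-conicalˡ _ _ (proj₂ (proj₂ tail) i)

  onlyNegativesTaken : ℕ → Bool
  onlyNegativesTaken z = z <ᵇ 2

  goodPerm⇒accepts : (π : Vec (Fin m) m) → GoodPerm π → accepts 0 onlyNegativesTaken π ≡ true
  goodPerm⇒accepts π (inj , disp) = valid⇒accepts 0 onlyNegativesTaken π
    ( inj
    , (λ i → admissible⇒allowed (toℕ (lookup π i)) (toℕ i) (subst Admissible (m-n≡m⊖n _ (toℕ i)) (disp i)))
    , (λ _ → refl))

  accepts⇒goodPerm : (π : Vec (Fin m) m) → accepts 0 onlyNegativesTaken π ≡ true → GoodPerm π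
  accepts⇒goodPerm π ok with accepts⇒valid 0 onlyNegativesTaken π ok
  ... | inj , allow , _ = inj , λ i → subst Admissible (sym (m-n≡m⊖n (toℕ (lookup π i)) (toℕ i)))
                               (allowed⇒admissible (toℕ (lookup π i)) (toℕ i) (allow i))

  placements : ℕ → (ℕ → Bool) → ℕ → ℕ
  placements o w k = count (accepts o w) (allVecs (allFin m) k)

  placeNext : ℕ → (ℕ → Bool) → ℕ → ℕ → ℕ
  placeNext o w k y = if w (2 + y) then 0 else placements (suc o) (fill w (2 + y)) k

  placements-suc : ∀ o w k →
    placements o w (suc k) ≡ sum (applyUpTo (λ y → if allowed o y then placeNext o w k y else 0) m)
  placements-suc o w k = trans (count-allVecs (allFin m) k (accepts o w)) (sum-tabulate m (λ i → i) _ _ λ i →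
    trans (count-if-∧ _ (accepts (suc o) (fill w (2 + toℕ i))) (allVecs (allFin m) k))
          (if-∧-not (allowed o (toℕ i)) (w (2 + toℕ i)) _))

  Counts : ℕ → Set
  Counts k = ∀ o w {b₀ b₁ b₂ b₃} → o + k ≡ m → Window o w b₀ b₁ b₂ b₃ →
    placements o w k ≡ arrangements b₀ b₁ b₂ b₃ k

  private
    <⇒<ᵇ≡true : ∀ {p q} → p < q → (p <ᵇ q) ≡ true
    <⇒<ᵇ≡true p<q = Equivalence.to T-≡ (<⇒<ᵇ p<q)

    below-m : ∀ {o k} → o + suc k ≡ m → o < m
    below-m {o} eq = subst (o <_) eq (m<m+n o z<s)

    skip-if : ∀ {b b′} (x x′ : ℕ) → b ≡ b′ → x ≡ x′ → (if b then 0 else x) ≡ (if b′ then 0 else x′)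
    skip-if _ _ refl refl = refl

    skipped : ∀ {b} (x : ℕ) → b ≡ true → (if b then 0 else x) ≡ 0
    skipped _ refl = refl

  sum-take₋₂ : ∀ {k} → Counts k → ∀ o w {b₀ b₁ b₂ b₃} → o + suc k ≡ m → Window o w b₀ b₁ b₂ b₃ →
    sum (applyUpTo (λ y → if 2 + y ≡ᵇ o then placeNext o w k y else 0) m) ≡
    (if b₀ then 0 else arrangements b₁ b₂ b₃ false k)
  sum-take₋₂ IH zero w eq W =
    trans (sum-applyUpTo-0 m) (sym (skipped _ (trans (sym (Window.at₀ W)) (proj₁ (Window.negatives W)))))
  sum-take₋₂ IH 1 w eq W =
    trans (sum-applyUpTo-0 m) (sym (skipped _ (trans (sym (Window.at₀ W)) (proj₂ (Window.negatives W)))))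
  sum-take₋₂ {k} IH (suc (suc p)) w {b₀} {b₁} {b₂} {b₃} eq W = begin
    sum (applyUpTo (λ y → if y ≡ᵇ p then placeNext (2 + p) w k y else 0) m)
      ≡⟨ sum-indicator m p _ ⟩
    (if p <ᵇ m then placeNext (2 + p) w k p else 0)
      ≡⟨ cong (λ b → if b then placeNext (2 + p) w k p else 0)
              (<⇒<ᵇ≡true (<-trans (m<n+m p {2} z<s) (below-m {2 + p} {k} eq))) ⟩
    placeNext (2 + p) w k p
      ≡⟨ skip-if _ _ (Window.at₀ W)
                 (IH (3 + p) (fill w (2 + p)) (trans (sym (+-suc (2 + p) k)) eq) (Window-take₋₂ W)) ⟩
    (if b₀ then 0 else arrangements b₁ b₂ b₃ false k) ∎
    where open ≡-Reasoning

  sum-take₋₁ : ∀ {k} → Counts k → ∀ o w {b₀ b₁ b₂ b₃} → o + suc k ≡ m → Window o w b₀ b₁ b₂ b₃ →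
    sum (applyUpTo (λ y → if 1 + y ≡ᵇ o then placeNext o w k y else 0) m) ≡
    (if b₁ then 0 else arrangements true b₂ b₃ false k)
  sum-take₋₁ IH zero w eq W =
    trans (sum-applyUpTo-0 m) (sym (skipped _ (trans (sym (Window.at₁ W)) (proj₂ (Window.negatives W)))))
  sum-take₋₁ {k} IH (suc p) w {b₀} {b₁} {b₂} {b₃} eq W = begin
    sum (applyUpTo (λ y → if y ≡ᵇ p then placeNext (1 + p) w k y else 0) m)
      ≡⟨ sum-indicator m p _ ⟩
    (if p <ᵇ m then placeNext (1 + p) w k p else 0)
      ≡⟨ cong (λ b → if b then placeNext (1 + p) w k p else 0)
              (<⇒<ᵇ≡true (<-trans (n<1+n p) (below-m {1 + p} {k} eq))) ⟩
    placeNext (1 + p) w k p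
      ≡⟨ skip-if _ _ (Window.at₁ W)
                 (IH (2 + p) (fill w (2 + p)) (trans (sym (+-suc (1 + p) k)) eq) (Window-take₋₁ W)) ⟩
    (if b₁ then 0 else arrangements true b₂ b₃ false k) ∎
    where open ≡-Reasoning

  sum-take₊₂ : ∀ {k} → Counts k → ∀ o w {b₀ b₁ b₂ b₃} → o + suc k ≡ m → Window o w b₀ b₁ b₂ b₃ →
    sum (applyUpTo (λ y → if y ≡ᵇ 2 + o then placeNext o w k y else 0) m) ≡
    (if 2 <ᵇ suc k then arrangements b₁ b₂ b₃ true k else 0)
  sum-take₊₂ {k} IH o w eq W = trans (sum-indicator m (2 + o) _)
    (cong₂ (λ b x → if b then x else 0) (trans (cong (2 + o <ᵇ_) (sym eq)) (fits o))
      (trans (skip-if _ _ (Window.beyond W (4 + o) ≤-refl) refl)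
             (IH (suc o) (fill w (4 + o)) (trans (sym (+-suc o k)) eq) (Window-take₊₂ W))))
    where
    fits : ∀ o → (2 + o <ᵇ o + suc k) ≡ (2 <ᵇ suc k)
    fits zero = refl
    fits (suc o) = fits o

  placements≡arrangements : ∀ k → Counts k
  placements≡arrangements zero o w eq W = refl
  placements≡arrangements (suc k) o w {b₀} {b₁} {b₂} {b₃} eq W = begin
    placements o w (suc k)
      ≡⟨ placements-suc o w k ⟩
    sum (applyUpTo (λ y → if allowed o y then next y else 0) m)
      ≡⟨ sum-applyUpTo-cong (λ y → split-allowed o y (next y)) m ⟩
    sum (applyUpTo (λ y → take₋₂ y + (take₋₁ y + take₊₂ y)) m)
      ≡⟨ sum-applyUpTo-+ take₋₂ _ m ⟩
    sum (applyUpTo take₋₂ m) + sum (applyUpTo (λ y → take₋₁ y + take₊₂ y) m)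
      ≡⟨ cong (sum (applyUpTo take₋₂ m) +_) (sum-applyUpTo-+ take₋₁ take₊₂ m) ⟩
    sum (applyUpTo take₋₂ m) + (sum (applyUpTo take₋₁ m) + sum (applyUpTo take₊₂ m))
      ≡⟨ cong₂ _+_ (sum-take₋₂ IH o w eq W)
                   (cong₂ _+_ (sum-take₋₁ IH o w eq W) (sum-take₊₂ IH o w eq W)) ⟩
    arrangements b₀ b₁ b₂ b₃ (suc k) ∎
    where
    open ≡-Reasoning
    IH : Counts k
    IH = placements≡arrangements k
    next : ℕ → ℕ
    next = placeNext o w k
    take₋₂ take₋₁ take₊₂ : ℕ → ℕ
    take₋₂ y = if 2 + y ≡ᵇ o then next y else 0
    take₋₁ y = if 1 + y ≡ᵇ o then next y else 0
    take₊₂ y = if y ≡ᵇ 2 + o then next y else 0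

  numGoodPerms≡arrangements : numGoodPerms m ≡ arrangements true true false false m
  numGoodPerms≡arrangements =
    trans (length-filter≡count goodPerm? (accepts 0 onlyNegativesTaken)
             (λ π → does≡ (goodPerm? π) (goodPerm⇒accepts π) (accepts⇒goodPerm π)) (allVecs (allFin m) m))
          (placements≡arrangements m 0 onlyNegativesTaken refl initial)
    where
    initial : Window 0 onlyNegativesTaken true true false false
    initial = record
      { negatives = refl , refl ; at₀ = refl ; at₁ = refl ; at₂ = refl ; at₃ = refl
      ; beyond = λ { (suc (suc z)) _ → refl ; 1 (s≤s ()) } }

-- The recurrence a (n + 6) + a n = a (n + 2) + a (n + 3) + a (n + 4)

record RecAt (f : ℕ → ℕ) (n : ℕ) : Set where
  constructor recAt
  field holds : f (6 + n) + f n ≡ f (2 + n) + f (3 + n) + f (4 + n)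
open RecAt

RecAt-+ : ∀ {f g n} → RecAt f n → RecAt g n → RecAt (λ k → f k + g k) n
RecAt-+ {f} {g} {n} rf rg = recAt (begin
  (f (6 + n) + g (6 + n)) + (f n + g n)                          ≡⟨ +-interchange (f (6 + n)) _ _ _ ⟩
  (f (6 + n) + f n) + (g (6 + n) + g n)                          ≡⟨ cong₂ _+_ (holds rf) (holds rg) ⟩
  (f (2 + n) + f (3 + n) + f (4 + n)) + (g (2 + n) + g (3 + n) + g (4 + n))
    ≡⟨ +-interchange (f (2 + n) + f (3 + n)) _ _ _ ⟩
  (f (2 + n) + f (3 + n) + (g (2 + n) + g (3 + n))) + (f (4 + n) + g (4 + n))
    ≡⟨ cong (_+ (f (4 + n) + g (4 + n))) (+-interchange (f (2 + n)) _ _ _) ⟩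
  (f (2 + n) + g (2 + n)) + (f (3 + n) + g (3 + n)) + (f (4 + n) + g (4 + n)) ∎)
  where open ≡-Reasoning

RecAt-if : ∀ {f n} b → RecAt f n → RecAt (λ k → if b then f k else 0) n
RecAt-if true rf = rf
RecAt-if false rf = recAt refl

RecAt-unless : ∀ {f n} b → (b ≡ false → RecAt f n) → RecAt (λ k → if b then 0 else f k) n
RecAt-unless true rf = recAt refl
RecAt-unless false rf = rf refl

RecAt-sum : ∀ {A : Set} {f : A → ℕ → ℕ} {n} → (∀ x → RecAt (f x) n) → ∀ xs → RecAt (λ k → sum (map (λ x → f x k) xs)) n
RecAt-sum rf [] = recAt refl
RecAt-sum rf (x ∷ xs) = RecAt-+ (rf x) (RecAt-sum rf xs)

RecAt-step : ∀ {f n} g → (∀ k → f (suc k) ≡ g k) → RecAt g n → RecAt f (suc n)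
RecAt-step {f} {n} g step rg = recAt (begin
  f (7 + n) + f (1 + n)               ≡⟨ cong₂ _+_ (step (6 + n)) (step n) ⟩
  g (6 + n) + g n                     ≡⟨ holds rg ⟩
  g (2 + n) + g (3 + n) + g (4 + n)   ≡⟨ sym (cong₂ _+_ (cong₂ _+_ (step (2 + n)) (step (3 + n))) (step (4 + n))) ⟩
  f (3 + n) + f (4 + n) + f (5 + n)   ∎)
  where open ≡-Reasoning

recurrence-unique : ∀ {f g} → (∀ n → RecAt f n) → (∀ n → RecAt g n) → (∀ i → i < 6 → f i ≡ g i) → ∀ n → f n ≡ g n
recurrence-unique {f} {g} rf rg initial n = agree n n (+-monoˡ-< n {0} {6} z<s)
  where
  agree : ∀ N i → i < 6 + N → f i ≡ g i
  agree zero = initial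
  agree (suc N) i i<7+N with m<1+n⇒m<n∨m≡n i<7+N
  ... | inj₁ i<6+N = agree N i i<6+N
  ... | inj₂ refl = +-cancelʳ-≡ (f N) (f (6 + N)) (g (6 + N)) (begin
      f (6 + N) + f N                     ≡⟨ holds (rf N) ⟩
      f (2 + N) + f (3 + N) + f (4 + N)   ≡⟨ cong₂ _+_ (cong₂ _+_ (earlier 2 _) (earlier 3 _)) (earlier 4 _) ⟩
      g (2 + N) + g (3 + N) + g (4 + N)   ≡⟨ sym (holds (rg N)) ⟩
      g (6 + N) + g N                     ≡⟨ cong (g (6 + N) +_) (sym (earlier 0 _)) ⟩
      g (6 + N) + f N                     ∎)
    where
    open ≡-Reasoning
    earlier : ∀ j → T (j <ᵇ 6) → f (j + N) ≡ g (j + N)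
    earlier j j<6 = agree N (j + N) (+-monoˡ-< N (<ᵇ⇒< j 6 j<6))

completions-RecAt : ∀ n a b c d → RecAt (completions a b c d) n
completions-RecAt zero false false false false = recAt refl
completions-RecAt zero false false false true = recAt refl
completions-RecAt zero false false true false = recAt refl
completions-RecAt zero false false true true = recAt refl
completions-RecAt zero false true false false = recAt refl
completions-RecAt zero false true false true = recAt refl
completions-RecAt zero false true true false = recAt refl
completions-RecAt zero false true true true = recAt refl
completions-RecAt zero true false false false = recAt refl
completions-RecAt zero true false false true = recAt refl
completions-RecAt zero true false true false = recAt refl
completions-RecAt zero true false true true = recAt refl
completions-RecAt zero true true false false = recAt refl
completions-RecAt zero true true false true = recAt refl
completions-RecAt zero true true true false = recAt refl
completions-RecAt zero true true true true = recAt refl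
completions-RecAt (suc n) a b c d = RecAt-step _ (completions-suc a b c d)
  (RecAt-+ (RecAt-if (localOK a b c d false) (completions-RecAt n b c d false))
           (RecAt-if (localOK a b c d true) (completions-RecAt n b c d true)))

-- The recurrence fails for some states with fewer than two taken values.
Dense : Bool → Bool → Bool → Bool → Set
Dense a b c d = T (2 ≤ᵇ count (λ x → x) (a ∷ b ∷ c ∷ d ∷ []))

dense-take₋₂ : ∀ b c d → Dense false b c d → Dense b c d false
dense-take₋₂ true true d _ = _
dense-take₋₂ true false true _ = _
dense-take₋₂ false true true _ = _
dense-take₋₂ true false false ()
dense-take₋₂ false true false ()
dense-take₋₂ false false true ()
dense-take₋₂ false false false ()

dense-take₋₁ : ∀ a c d → Dense a false c d → Dense true c d false
dense-take₋₁ a true d _ = _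
dense-take₋₁ a false true _ = _
dense-take₋₁ true false false ()
dense-take₋₁ false false false ()

dense-take₊₂ : ∀ a b c d → Dense a b c d → Dense b c d true
dense-take₊₂ a true true true _ = _
dense-take₊₂ a true true false _ = _
dense-take₊₂ a true false true _ = _
dense-take₊₂ a true false false _ = _
dense-take₊₂ a false true true _ = _
dense-take₊₂ a false true false _ = _
dense-take₊₂ a false false true _ = _
dense-take₊₂ true false false false ()
dense-take₊₂ false false false false ()

arrangements-RecAt : ∀ n a b c d → Dense a b c d → RecAt (λ k → arrangements a b c d (2 + k)) n
arrangements-RecAt zero false false true true _ = recAt refl
arrangements-RecAt zero false true false true _ = recAt refl
arrangements-RecAt zero false true true false _ = recAt refl
arrangements-RecAt zero false true true true _ = recAt refl
arrangements-RecAt zero true false false true _ = recAt refl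
arrangements-RecAt zero true false true false _ = recAt refl
arrangements-RecAt zero true false true true _ = recAt refl
arrangements-RecAt zero true true false false _ = recAt refl
arrangements-RecAt zero true true false true _ = recAt refl
arrangements-RecAt zero true true true false _ = recAt refl
arrangements-RecAt zero true true true true _ = recAt refl
arrangements-RecAt zero false false false false ()
arrangements-RecAt zero false false false true ()
arrangements-RecAt zero false false true false ()
arrangements-RecAt zero false true false false ()
arrangements-RecAt zero true false false false ()
arrangements-RecAt (suc n) a b c d D = RecAt-step
  (λ k → (if a then 0 else arrangements b c d false (2 + k)) +
         ((if b then 0 else arrangements true c d false (2 + k)) + arrangements b c d true (2 + k)))
  (λ _ → refl)
  (RecAt-+ (RecAt-unless a λ { refl → arrangements-RecAt n b c d false (dense-take₋₂ b c d D) })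
    (RecAt-+ (RecAt-unless b λ { refl → arrangements-RecAt n true c d false (dense-take₋₁ a c d D) })
             (arrangements-RecAt n b c d true (dense-take₊₂ a b c d D))))

permCount : ℕ → ℕ
permCount n = arrangements true true false false (2 + (4 + n))

maximalCount-RecAt : ∀ n → RecAt maximalCount n
maximalCount-RecAt n = RecAt-sum (λ c → RecAt-sum (λ d → completions-RecAt n false false c d) bits) bits

permCount-RecAt : ∀ n → RecAt permCount n
permCount-RecAt n = recAt (holds (arrangements-RecAt (4 + n) true true false false _))

initialValues : ∀ i → i < 6 → maximalCount i ≡ permCount i
initialValues 0 _ = refl
initialValues 1 _ = refl
initialValues 2 _ = refl
initialValues 3 _ = refl
initialValues 4 _ = refl
initialValues 5 _ = refl
initialValues (suc (suc (suc (suc (suc (suc i)))))) (s≤s (s≤s (s≤s (s≤s (s≤s (s≤s ()))))))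

theorem2p3 : (n : ℕ) → numMaximal (suc n) ≡ numGoodPerms (suc n + 4)
theorem2p3 zero = refl
theorem2p3 (suc n) = begin
  numMaximal (suc (suc n))                             ≡⟨ numMaximal≡maximalCount n ⟩
  maximalCount n                                       ≡⟨ recurrence-unique maximalCount-RecAt permCount-RecAt initialValues n ⟩
  permCount n                                          ≡⟨ cong (λ k → arrangements true true false false (2 + k)) (+-comm 4 n) ⟩
  arrangements true true false false (suc (suc n) + 4) ≡⟨ Placements.numGoodPerms≡arrangements (suc (suc n) + 4) ⟨
  numGoodPerms (suc (suc n) + 4)                       ∎
  where open ≡-Reasoning
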